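{- Suppose that $\mathrm{mac}(G)\ge\frac45 w(G)$ holds for every connected edge-weighted triangle-free graph $G$ with $\Delta(G)\le 3$. Then for every connected edge-weighted triangle-free graph $G$ with $\Delta(G)\le 3$ and every spanning tree $T$ of $G$, $\mathrm{mac}(G)\ge\frac{w(G)}{2}+\frac{3}{8}w(T)$.
   Context: Edge weights are non-negative reals; for a subgraph $H$, $w(H)=\sum_{e\in E(H)}w(e)$. $\mathrm{mac}(G)$ is the maximum total weight of the edges between $A$ and $B$ over all partitions $(A,B)$ of $V(G)$. Triangle-free means containing no $K_3$ subgraph; $\Delta(G)$ is the maximum degree.
   Formalization: The edge weights are non-negative rationals instead of non-negative reals. -}

module Defs where

open import Data.Nat using (ℕ; zero; suc) renaming (_≤_ to _≤ℕ_)
open import Data.Nat.Base using (_<ᵇ_)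
open import Data.Bool using (Bool; true; false; _∧_; _xor_; if_then_else_)
open import Data.Fin using (Fin; toℕ)
open import Data.List using (List; []; _∷_; foldr; map; allFin; concatMap; length; filter; _++_)
open import Data.List.Relation.Unary.Unique.Propositional using (Unique)
open import Data.List.Relation.Unary.Linked using (Linked)
open import Data.Vec using (Vec; lookup) renaming ([] to []ᵛ; _∷_ to _∷ᵛ_)
open import Data.Rational using (ℚ; 0ℚ; _+_; _⊔_; _≤_)
open import Data.Product using (Σ; _×_; ∃)
open import Relation.Binary.PropositionalEquality using (_≡_)
open import Relation.Nullary using (¬_)

record Graph (n : ℕ) : Set where
  field
    adj    : Fin n → Fin n → Bool
    sym    : ∀ i j → adj i j ≡ adj j i
    irrefl : ∀ i → adj i i ≡ false
open Graph public

-- Edge weights: a function on vertex pairs; only values on edges matter.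
Weight : ℕ → Set
Weight n = Fin n → Fin n → ℚ

NonNegWeights : ∀ {n} → Graph n → Weight n → Set
NonNegWeights G w = ∀ i j → adj G i j ≡ true → 0ℚ ≤ w i j

sumℚ : List ℚ → ℚ
sumℚ = foldr _+_ 0ℚ

sumPairs : ∀ {n} → (Fin n → Fin n → Bool) → Weight n → ℚ
sumPairs {n} P w =
  sumℚ (map (λ i → sumℚ (map (λ j →
    if (P i j ∧ (toℕ i <ᵇ toℕ j)) then w i j else 0ℚ) (allFin n))) (allFin n))

weight : ∀ {n} → Graph n → Weight n → ℚ
weight H w = sumPairs (adj H) w

-- All partitions (A,B) of Fin n, encoded by the indicator vector of A.
allParts : ∀ n → List (Vec Bool n)
allParts zero    = []ᵛ ∷ []
allParts (suc n) = concatMap (λ v → (true ∷ᵛ v) ∷ (false ∷ᵛ v) ∷ []) (allParts n)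

cutWeight : ∀ {n} → Graph n → Weight n → Vec Bool n → ℚ
cutWeight G w p = sumPairs (λ i j → adj G i j ∧ (lookup p i xor lookup p j)) w

mac : ∀ {n} → Graph n → Weight n → ℚ
mac G w = foldr _⊔_ 0ℚ (map (cutWeight G w) (allParts _))

data Reach {n} (G : Graph n) : Fin n → Fin n → Set where
  here : ∀ {u} → Reach G u u
  step : ∀ {u v x} → adj G u v ≡ true → Reach G v x → Reach G u x

Connected : ∀ {n} → Graph n → Set
Connected G = ∀ u v → Reach G u v

TriangleFree : ∀ {n} → Graph n → Set
TriangleFree G = ∀ a b c → ¬ (adj G a b ≡ true × adj G b c ≡ true × adj G a c ≡ true)

degree : ∀ {n} → Graph n → Fin n → ℕ
degree {n} G v = length (filter (λ u → adj G v u Data.Bool.≟ true) (allFin n))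
  where import Data.Bool

MaxDegreeAtMost : ∀ {n} → ℕ → Graph n → Set
MaxDegreeAtMost k G = ∀ v → degree G v ≤ℕ k

HasCycle : ∀ {n} → Graph n → Set
HasCycle G = Σ _ λ v → Σ (List _) λ vs →
  Unique (v ∷ vs) × (2 ≤ℕ length vs) × Linked (λ a b → adj G a b ≡ true) (v ∷ vs ++ v ∷ [])

Acyclic : ∀ {n} → Graph n → Set
Acyclic G = ¬ HasCycle G

Subgraph : ∀ {n} → Graph n → Graph n → Set
Subgraph H G = ∀ i j → adj H i j ≡ true → adj G i j ≡ true

SpanningTree : ∀ {n} → Graph n → Graph n → Set
SpanningTree T G = Subgraph T G × Connected T × Acyclic T

{-# OPTIONS --safe #-}
module Submission where

-- A spanning tree T is bipartite, and the 2-colouring of T is a cut of G containing every edge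
-- of T, so mac(G) ≥ w(T). The claimed bound is then the convex combination
-- 5/8 · (4/5 · w(G)) + 3/8 · w(T) of this inequality and the hypothesis mac(G) ≥ 4/5 · w(G).
-- A tree is 2-coloured by the parity of the length of a walk from a fixed root: if two adjacent
-- vertices got the same colour, the two walks and the edge would form a closed walk of odd
-- length, and splitting an odd closed walk at a repeated vertex always leaves a shorter odd
-- closed walk, so eventually one without repeated vertices, i.e. an (odd) cycle.

open import Defs
open import Data.Nat using (ℕ)
open import Data.Integer using (+_)
open import Data.Rational using (ℚ; _/_; _+_; _*_; _≤_)

open import Data.Bool using (Bool; true; false; _∧_; _xor_; if_then_else_)
open import Data.Empty using (⊥-elim)
open import Data.Fin using (Fin) renaming (zero to fzero)
open import Data.Fin.Properties using (_≟_)
open import Data.List using (List; []; _∷_; _++_; [_]; length; map; foldr; allFin)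
open import Data.List.Properties using (++-assoc; length-++; length-++-comm)
open import Data.List.Membership.Propositional using (_∈_)
open import Data.List.Membership.Propositional.Properties using (∈-∃++; ∈-map⁺; ∈-concatMap⁺)
open import Data.List.Relation.Unary.All.Properties using (¬Any⇒All¬)
open import Data.List.Relation.Unary.Any using (here; there; any?)
import Data.List.Relation.Unary.Any as Any
open import Data.List.Relation.Unary.AllPairs using ([]; _∷_)
open import Data.List.Relation.Unary.Linked using (Linked; []; [-]; _∷_)
open import Data.List.Relation.Unary.Unique.Propositional using (Unique)
open import Data.Nat using (suc; s≤s; z<s; parity)
import Data.Nat as ℕ
import Data.Nat.Properties as ℕₚ
open import Data.Parity.Base using (Parity; 0ℙ; 1ℙ; _⁻¹) renaming (_+_ to _+ℙ_)
open import Data.Parity.Properties using (+-homo-+; suc-homo-⁻¹)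
open import Data.Product using (∃; ∃₂; _×_; _,_)
import Data.Product as Product
open import Data.Rational using (0ℚ; 1ℚ; _⊔_; NonNegative)
open import Data.Rational.Properties
  using (≤-refl; ≤-trans; +-mono-≤; *-monoˡ-≤-nonNeg; *-distribʳ-+; *-identityˡ; *-assoc; p≤p⊔q; p≤q⊔p)
  renaming (module ≤-Reasoning to ℚ-≤-Reasoning)
open import Data.Sum using (_⊎_; inj₁; inj₂)
open import Data.Vec using (Vec; lookup; tabulate) renaming ([] to []ᵛ; _∷_ to _∷ᵛ_)
open import Data.Vec.Properties using (lookup∘tabulate)
open import Function using (_∘_)
open import Level using () renaming (_⊔_ to _⊔ˡ_)
open import Relation.Binary.Core using (Rel)
open import Relation.Binary.Definitions using (DecidableEquality)
open import Relation.Binary.PropositionalEquality using (_≡_; refl; cong; subst; trans; module ≡-Reasoning)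
import Relation.Binary.PropositionalEquality as ≡
open import Relation.Nullary using (yes; no)

Duplicate : ∀ {a} {A : Set a} → List A → Set a
Duplicate xs = ∃ λ ps → ∃ λ x → ∃ λ qs → ∃ λ rs → xs ≡ ps ++ x ∷ qs ++ x ∷ rs

unique⊎duplicate : ∀ {a} {A : Set a} → DecidableEquality A → (xs : List A) → Unique xs ⊎ Duplicate xs
unique⊎duplicate _≟_ []       = inj₁ []
unique⊎duplicate _≟_ (x ∷ xs) with any? (x ≟_) xs
... | yes x∈xs = let qs , rs , xs≡ = ∈-∃++ x∈xs in inj₂ ([] , x , qs , rs , cong (x ∷_) xs≡)
... | no  x∉xs with unique⊎duplicate _≟_ xs
...   | inj₁ unique                   = inj₁ (¬Any⇒All¬ xs x∉xs ∷ unique)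
...   | inj₂ (ps , y , qs , rs , xs≡) = inj₂ (x ∷ ps , y , qs , rs , cong (x ∷_) xs≡)

length-rotate : ∀ {a} {A : Set a} (xs : List A) {x y : A} ys → length (xs ++ x ∷ ys) ≡ length (ys ++ y ∷ xs)
length-rotate xs {x} {y} ys = begin
  length (xs ++ x ∷ ys)   ≡⟨ length-++-comm xs (x ∷ ys) ⟩
  suc (length (ys ++ xs)) ≡⟨ cong suc (length-++-comm ys xs) ⟩
  suc (length (xs ++ ys)) ≡⟨ length-++-comm ys (y ∷ xs) ⟨
  length (ys ++ y ∷ xs)   ∎
  where open ≡-Reasoning

module _ {a ℓ} {A : Set a} {R : Rel A ℓ} where

  Linked-split : ∀ xs {x ys} → Linked R (xs ++ x ∷ ys) → Linked R (xs ++ [ x ]) × Linked R (x ∷ ys)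
  Linked-split []           l       = [-] , l
  Linked-split (_ ∷ [])     (r ∷ l) = r ∷ [-] , l
  Linked-split (_ ∷ y ∷ xs) (r ∷ l) = Product.map₁ (r ∷_) (Linked-split (y ∷ xs) l)

  Linked-glue : ∀ xs {x ys} → Linked R (xs ++ [ x ]) → Linked R (x ∷ ys) → Linked R (xs ++ x ∷ ys)
  Linked-glue []           _       l′ = l′
  Linked-glue (_ ∷ [])     (r ∷ _) l′ = r ∷ l′
  Linked-glue (_ ∷ y ∷ xs) (r ∷ l) l′ = r ∷ Linked-glue (y ∷ xs) l l′

  -- The closed walk v, vs₁, …, vsₖ, v, of length k + 1.
  ClosedWalk : A → List A → Set (a ⊔ˡ ℓ)
  ClosedWalk v vs = Linked R (v ∷ vs ++ [ v ])

  closedWalk-rotate : ∀ {v} xs {x} ys → ClosedWalk v (xs ++ x ∷ ys) → ClosedWalk x (ys ++ v ∷ xs)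
  closedWalk-rotate {v} xs {x} ys w
    with Linked-split (v ∷ xs) (subst (Linked R ∘ (v ∷_)) (++-assoc xs (x ∷ ys) [ v ]) w)
  ... | fromV , toV =
    subst (Linked R ∘ (x ∷_)) (≡.sym (++-assoc ys (v ∷ xs) [ x ])) (Linked-glue (x ∷ ys) toV fromV)

  closedWalk-split : ∀ {x} ys zs → ClosedWalk x (ys ++ x ∷ zs) → ClosedWalk x ys × ClosedWalk x zs
  closedWalk-split {x} ys zs w = Linked-split (x ∷ ys) (subst (Linked R ∘ (x ∷_)) (++-assoc ys (x ∷ zs) [ x ]) w)

  closedWalk-atRepeat : ∀ {v vs} → ClosedWalk v vs → Duplicate (v ∷ vs) →
    ∃ λ x → ∃₂ λ ys zs → ClosedWalk x (ys ++ x ∷ zs) × length vs ≡ length (ys ++ x ∷ zs)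
  closedWalk-atRepeat w ([] , x , ys , zs , refl) = x , ys , zs , w , refl
  closedWalk-atRepeat w (v ∷ ps , x , ys , zs , refl) =
    x , ys , zs ++ v ∷ ps ,
    subst (ClosedWalk x) (++-assoc ys (x ∷ zs) (v ∷ ps)) (closedWalk-rotate ps (ys ++ x ∷ zs) w) ,
    trans (length-rotate ps (ys ++ x ∷ zs)) (cong length (++-assoc ys (x ∷ zs) (v ∷ ps)))

+ℙ-odd : ∀ p q → p +ℙ q ≡ 1ℙ → p ≡ 1ℙ ⊎ q ≡ 1ℙ
+ℙ-odd 1ℙ _  _ = inj₁ refl
+ℙ-odd 0ℙ 1ℙ _ = inj₂ refl

module _ {a ℓ} {A : Set a} (_≟_ : DecidableEquality A) {R : Rel A ℓ} where

  OddSimpleClosedWalk : Set (a ⊔ˡ ℓ)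
  OddSimpleClosedWalk =
    ∃₂ λ v vs → Unique (v ∷ vs) × ClosedWalk {R = R} v vs × parity (length (v ∷ vs)) ≡ 1ℙ

  oddClosedWalk⇒simple : ∀ {v vs} → ClosedWalk {R = R} v vs → parity (length (v ∷ vs)) ≡ 1ℙ →
                         OddSimpleClosedWalk
  oddClosedWalk⇒simple {vs = vs} = shorten (suc (length vs)) ℕₚ.≤-refl
    where
    shorten : ∀ k {v} {vs : List A} → length vs ℕ.< k →
              ClosedWalk {R = R} v vs → parity (length (v ∷ vs)) ≡ 1ℙ → OddSimpleClosedWalk
    splitAtRepeat : ∀ k {x : A} ys zs → length ys ℕ.+ suc (length zs) ℕ.≤ k →
                    ClosedWalk {R = R} x (ys ++ x ∷ zs) → parity (suc (length ys) ℕ.+ suc (length zs)) ≡ 1ℙ →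
                    OddSimpleClosedWalk

    shorten (suc k) {v} {vs} (s≤s vs≤k) w odd with unique⊎duplicate _≟_ (v ∷ vs)
    ... | inj₁ unique = v , vs , unique , w , odd
    ... | inj₂ dup with closedWalk-atRepeat w dup
    ...   | x , ys , zs , w′ , vs≡ =
      splitAtRepeat k ys zs (subst (ℕ._≤ k) len≡ vs≤k) w′ (subst (λ m → parity (suc m) ≡ 1ℙ) len≡ odd)
      where
      len≡ : length vs ≡ length ys ℕ.+ suc (length zs)
      len≡ = trans vs≡ (length-++ ys)

    splitAtRepeat k ys zs ≤k w odd
      with closedWalk-split ys zs w | +ℙ-odd _ _ (trans (≡.sym (+-homo-+ (suc (length ys)) _)) odd)
    ... | wys , _ | inj₁ oddys = shorten k (ℕₚ.<-≤-trans (ℕₚ.m<m+n (length ys) z<s) ≤k) wys oddys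
    ... | _ , wzs | inj₂ oddzs = shorten k (ℕₚ.≤-trans (ℕₚ.m≤n+m (suc (length zs)) (length ys)) ≤k) wzs oddzs

Edge : ∀ {n} → Graph n → Fin n → Fin n → Set
Edge G i j = adj G i j ≡ true

oddClosedWalk⇒cycle : ∀ {n} (G : Graph n) {v vs} → ClosedWalk {R = Edge G} v vs →
  parity (length (v ∷ vs)) ≡ 1ℙ → HasCycle G
oddClosedWalk⇒cycle G w odd with oddClosedWalk⇒simple _≟_ w odd
... | u , us , unique , w′ , odd′ = u , us , unique , atLeastTwo us w′ odd′ , w′
  where
  atLeastTwo : ∀ {u} us → ClosedWalk {R = Edge G} u us → parity (length (u ∷ us)) ≡ 1ℙ → 2 ℕ.≤ length us
  atLeastTwo {u} [] (loop ∷ [-]) _ with trans (≡.sym loop) (irrefl G u)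
  ... | ()
  atLeastTwo (_ ∷ [])    _ ()
  atLeastTwo (_ ∷ _ ∷ _) _ _ = s≤s (s≤s ℕ.z≤n)

module _ {n} {G : Graph n} where

  -- The vertices a walk leaves, so the endpoint is omitted and the length is the number of steps.
  steps : ∀ {u x} → Reach G u x → List (Fin n)
  steps here               = []
  steps (step {u = u} _ r) = u ∷ steps r

  len : ∀ {u x} → Reach G u x → ℕ
  len = length ∘ steps

  steps-linked : ∀ {u x} (r : Reach G u x) → Linked (Edge G) (steps r ++ [ x ])
  steps-linked here                  = [-]
  steps-linked (step e here)         = e ∷ [-]
  steps-linked (step e r@(step _ _)) = e ∷ steps-linked r

  _▻_ : ∀ {u v x} → Reach G u v → Reach G v x → Reach G u x
  here     ▻ s = s
  step e r ▻ s = step e (r ▻ s)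

  len-▻ : ∀ {u v x} (r : Reach G u v) (s : Reach G v x) → len (r ▻ s) ≡ len r ℕ.+ len s
  len-▻ here       s = refl
  len-▻ (step _ r) s = cong suc (len-▻ r s)

  reverse : ∀ {u x} → Reach G u x → Reach G x u
  reverse here       = here
  reverse (step e r) = reverse r ▻ step (trans (Graph.sym G _ _) e) here

  len-reverse : ∀ {u x} (r : Reach G u x) → len (reverse r) ≡ len r
  len-reverse here       = refl
  len-reverse (step e r) = begin
    len (reverse r ▻ step _ here) ≡⟨ len-▻ (reverse r) _ ⟩
    len (reverse r) ℕ.+ 1         ≡⟨ ℕₚ.+-comm _ 1 ⟩
    suc (len (reverse r))         ≡⟨ cong suc (len-reverse r) ⟩
    suc (len r)                   ∎
    where open ≡-Reasoning

  acyclic⇒closedWalk-even : Acyclic G → ∀ {u} (r : Reach G u u) → parity (len r) ≡ 0ℙ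
  acyclic⇒closedWalk-even acyclic here = refl
  acyclic⇒closedWalk-even acyclic (step e r) with parity (len (step e r)) in parity≡
  ... | 0ℙ = refl
  ... | 1ℙ = ⊥-elim (acyclic (oddClosedWalk⇒cycle G (steps-linked (step e r)) parity≡))

ProperColouring : ∀ {n} → Graph n → Vec Bool n → Set
ProperColouring G p = ∀ i j → adj G i j ≡ true → (lookup p i xor lookup p j) ≡ true

isOdd : Parity → Bool
isOdd 0ℙ = false
isOdd 1ℙ = true

isOdd-xor : ∀ p q → p +ℙ q ⁻¹ ≡ 0ℙ → (isOdd p xor isOdd q) ≡ true
isOdd-xor 0ℙ 1ℙ _ = refl
isOdd-xor 1ℙ 0ℙ _ = refl

connectedAcyclic⇒properColouring : ∀ {n} (T : Graph n) → Connected T → Acyclic T → ∃ (ProperColouring T)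
connectedAcyclic⇒properColouring {ℕ.zero} T connected acyclic = []ᵛ , λ ()
connectedAcyclic⇒properColouring {suc n} T connected acyclic = tabulate colour , proper
  where
  walkFromRoot : ∀ v → Reach T fzero v
  walkFromRoot = connected fzero

  colour : Fin (suc n) → Bool
  colour = isOdd ∘ parity ∘ len ∘ walkFromRoot

  proper : ProperColouring T (tabulate colour)
  proper i j e rewrite lookup∘tabulate colour i | lookup∘tabulate colour j =
    isOdd-xor (parity (len ri)) (parity (len rj)) (begin
      parity (len ri) +ℙ parity (len rj) ⁻¹         ≡⟨ cong (parity (len ri) +ℙ_) (suc-homo-⁻¹ (suc (len rj))) ⟩
      parity (len ri) +ℙ parity (suc (len rj))      ≡⟨ +-homo-+ (len ri) (suc (len rj)) ⟨
      parity (len ri ℕ.+ suc (len rj))              ≡⟨ cong (λ m → parity (len ri ℕ.+ suc m)) (len-reverse rj) ⟨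
      parity (len ri ℕ.+ len (step e (reverse rj))) ≡⟨ cong parity (len-▻ ri (step e (reverse rj))) ⟨
      parity (len (ri ▻ step e (reverse rj)))       ≡⟨ acyclic⇒closedWalk-even acyclic (ri ▻ step e (reverse rj)) ⟩
      0ℙ                                            ∎)
    where
    open ≡-Reasoning
    ri : Reach T fzero i
    ri = walkFromRoot i
    rj : Reach T fzero j
    rj = walkFromRoot j

sumℚ-mono : ∀ {A : Set} (xs : List A) {f g : A → ℚ} → (∀ x → f x ≤ g x) → sumℚ (map f xs) ≤ sumℚ (map g xs)
sumℚ-mono []       _   = ≤-refl
sumℚ-mono (x ∷ xs) f≤g = +-mono-≤ (f≤g x) (sumℚ-mono xs f≤g)

if-∧-mono : ∀ {p q} b {x} → (p ≡ true → q ≡ true) → (q ≡ true → 0ℚ ≤ x) →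
            (if p ∧ b then x else 0ℚ) ≤ (if q ∧ b then x else 0ℚ)
if-∧-mono {true}          _     p⇒q _   rewrite p⇒q refl = ≤-refl
if-∧-mono {false} {false} _     _   _   = ≤-refl
if-∧-mono {false} {true}  false _   _   = ≤-refl
if-∧-mono {false} {true}  true  _   0≤x = 0≤x refl

sumPairs-mono : ∀ {n} {P Q : Fin n → Fin n → Bool} {w : Weight n} →
  (∀ i j → P i j ≡ true → Q i j ≡ true) → (∀ i j → Q i j ≡ true → 0ℚ ≤ w i j) →
  sumPairs P w ≤ sumPairs Q w
sumPairs-mono {n} P⇒Q nonNeg =
  sumℚ-mono (allFin n) λ i → sumℚ-mono (allFin n) λ j → if-∧-mono _ (P⇒Q i j) (nonNeg i j)

∧-trueˡ : ∀ {a b} → a ∧ b ≡ true → a ≡ true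
∧-trueˡ {true} _ = refl

weight≤cutWeight : ∀ {n} (G H : Graph n) (w : Weight n) (p : Vec Bool n) →
  NonNegWeights G w → Subgraph H G → ProperColouring H p → weight H w ≤ cutWeight G w p
weight≤cutWeight G H w p nonNeg H⊆G proper =
  sumPairs-mono crossing (λ i j → nonNeg i j ∘ ∧-trueˡ)
  where
  crossing : ∀ i j → adj H i j ≡ true → (adj G i j ∧ (lookup p i xor lookup p j)) ≡ true
  crossing i j e rewrite H⊆G i j e | proper i j e = refl

foldr-⊔-upper : ∀ {x xs} → x ∈ xs → x ≤ foldr _⊔_ 0ℚ xs
foldr-⊔-upper {xs = y ∷ _} (here refl)  = p≤p⊔q y _
foldr-⊔-upper {xs = y ∷ _} (there x∈ys) = ≤-trans (foldr-⊔-upper x∈ys) (p≤q⊔p y _)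

∈-allParts : ∀ {n} (p : Vec Bool n) → p ∈ allParts n
∈-allParts []ᵛ       = here refl
∈-allParts (b ∷ᵛ p) = ∈-concatMap⁺ _ (Any.map (λ { refl → extensions b }) (∈-allParts p))
  where
  extensions : ∀ b → (b ∷ᵛ p) ∈ (true ∷ᵛ p) ∷ (false ∷ᵛ p) ∷ []
  extensions true  = here refl
  extensions false = there (here refl)

cutWeight≤mac : ∀ {n} (G : Graph n) (w : Weight n) p → cutWeight G w p ≤ mac G w
cutWeight≤mac G w p = foldr-⊔-upper (∈-map⁺ (cutWeight G w) (∈-allParts p))

spanningTree-weight≤mac : ∀ {n} (G T : Graph n) (w : Weight n) →
  NonNegWeights G w → SpanningTree T G → weight T w ≤ mac G w
spanningTree-weight≤mac G T w nonNeg (T⊆G , connected , acyclic)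
  with connectedAcyclic⇒properColouring T connected acyclic
... | p , proper = ≤-trans (weight≤cutWeight G T w p nonNeg T⊆G proper) (cutWeight≤mac G w p)

convex-≤ : ∀ s t .{{_ : NonNegative s}} .{{_ : NonNegative t}} → s + t ≡ 1ℚ →
           ∀ {a b c} → a ≤ c → b ≤ c → s * a + t * b ≤ c
convex-≤ s t s+t≡1 {a} {b} {c} a≤c b≤c = begin
  s * a + t * b ≤⟨ +-mono-≤ (*-monoˡ-≤-nonNeg s a≤c) (*-monoˡ-≤-nonNeg t b≤c) ⟩
  s * c + t * c ≡⟨ *-distribʳ-+ c s t ⟨
  (s + t) * c   ≡⟨ cong (_* c) s+t≡1 ⟩
  1ℚ * c        ≡⟨ *-identityˡ c ⟩
  c             ∎
  where open ℚ-≤-Reasoning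

proposition5p7 :
    (∀ (n : ℕ) (G : Graph n) (w : Weight n) → NonNegWeights G w →
       Connected G → TriangleFree G → MaxDegreeAtMost 3 G →
       (+ 4 / 5) * weight G w ≤ mac G w) →
    ∀ (n : ℕ) (G : Graph n) (w : Weight n) → NonNegWeights G w →
      Connected G → TriangleFree G → MaxDegreeAtMost 3 G →
      (T : Graph n) → SpanningTree T G →
      (+ 1 / 2) * weight G w + (+ 3 / 8) * weight T w ≤ mac G w
proposition5p7 mac≥⅘w n G w nonNeg connected triangleFree subcubic T spanningTree = begin
  (+ 1 / 2) * weight G w + (+ 3 / 8) * weight T w
    ≡⟨ cong (_+ (+ 3 / 8) * weight T w) (*-assoc (+ 5 / 8) (+ 4 / 5) (weight G w)) ⟩
  (+ 5 / 8) * ((+ 4 / 5) * weight G w) + (+ 3 / 8) * weight T w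
    ≤⟨ convex-≤ (+ 5 / 8) (+ 3 / 8) refl
         (mac≥⅘w n G w nonNeg connected triangleFree subcubic)
         (spanningTree-weight≤mac G T w nonNeg spanningTree) ⟩
  mac G w ∎
  where open ℚ-≤-Reasoning
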